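{- Let $m$ and $n$ be positive integers with $m\le n$ and let $G$ be a graph. The Cartesian product $G\,\Box\,K_{m,n}$ is an efficient open domination graph if and only if $G$ is $K_{m,n}$-amenable.
   Context: All graphs are finite and simple. A graph $X$ is an efficient open domination graph if there is $D\subseteq V(X)$ with $\bigcup_{v\in D}N(v)=V(X)$ and $N(u)\cap N(v)=\emptyset$ for all distinct $u,v\in D$ ($N$ = open neighborhood). For $S\subseteq V(G)$, $\langle S\rangle$ is the induced subgraph, and "$\langle S\rangle$ is a matching" means every vertex of $S$ has exactly one neighbor in $S$ (empty $S$ allowed). A weak partition of a set is a collection of pairwise disjoint, possibly empty, subsets whose union is the set. Take $K_{m,n}$ with partite sets $\{1,\dots,m\}$ and $\{m+1,\dots,m+n\}$. A graph $G$ is $K_{m,n}$-amenable if $V(G)$ has a weak partition consisting of $mn+m+n+1$ parts $V_0,V_1,\dots,V_{m+n}$ and $V_{[i,m+j]}$ ($1\le i\le m$, $1\le j\le n$) such that: (I) for $1\le i\le m+n$, $\langle V_i\rangle$ is a matching; (II) for $1\le i\le m$ and $m+1\le j\le m+n$, $\langle V_i\cup V_j\rangle$ is a matching; (III) for $1\le i<j\le m$ or $m+1\le i<j\le m+n$, each $x\in V_i$ has exactly one neighbor in $V_j$ and each $y\in V_j$ has exactly one neighbor in $V_i$; (IV) if $x\in V_{[i,m+j]}$ for some $1\le i\le m$, $1\le j\le n$, then $N(x)\subseteq V_0$; (V) if $x\in V_0$, then $\bigl|N(x)\cap\bigl(\bigcup_{1\le j\le n}V_{[i,m+j]}\cup V_i\bigr)\bigr|=1$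 for each $1\le i\le m$, and $\bigl|N(x)\cap\bigl(\bigcup_{1\le i\le m}V_{[i,m+j]}\cup V_{m+j}\bigr)\bigr|=1$ for each $1\le j\le n$. -}

module Defs where

open import Data.Nat using (ℕ; _+_)
open import Data.Bool using (Bool; true; false; _∧_; _∨_)
open import Data.Fin using (Fin; _<_)
open import Data.Sum using (_⊎_; inj₁; inj₂)
open import Data.Product using (_×_; _,_; ∃; ∃-syntax)
open import Function.Bundles using (_↔_)
open import Relation.Binary.PropositionalEquality using (_≡_; _≢_; refl)
open import Relation.Nullary using (¬_)

record Graph : Set₁ where
  field
    Vertex : Set
    size   : ℕ
    enum   : Vertex ↔ Fin size
    adj    : Vertex → Vertex → Bool
    adj-sym     : ∀ u v → adj u v ≡ adj v u
    adj-irrefl  : ∀ v → adj v v ≡ false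
open Graph public

module _ {A : Set} (adjA : A → A → Bool) where

  Adj : A → A → Set
  Adj u v = adjA u v ≡ true

  ExactlyOneNbr : (A → Set) → A → Set
  ExactlyOneNbr P x =
    ∃[ w ] (P w × Adj x w × (∀ w′ → P w′ → Adj x w′ → w′ ≡ w))

  IsEODSet : (A → Bool) → Set
  IsEODSet D =
    (∀ x → ∃[ v ] (D v ≡ true × Adj v x)) ×
    (∀ u v → D u ≡ true → D v ≡ true → u ≢ v →
       ∀ x → ¬ (Adj u x × Adj v x))

  HasEOD : Set
  HasEOD = ∃[ D ] IsEODSet D

IsEODGraph : Graph → Set
IsEODGraph X = HasEOD (adj X)

open import Data.Fin using (_≟_)
open import Relation.Nullary using (yes; no)
open import Function.Bundles using (Inverse)

eqb : (G : Graph) → Vertex G → Vertex G → Bool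
eqb G u v with Inverse.to (enum G) u ≟ Inverse.to (enum G) v
... | yes _ = true
... | no  _ = false

□-adj : (G H : Graph) → Vertex G × Vertex H → Vertex G × Vertex H → Bool
□-adj G H (g , h) (g′ , h′) =
  (eqb G g g′ ∧ adj H h h′) ∨ (eqb H h h′ ∧ adj G g g′)

IsEOD□ : Graph → Graph → Set
IsEOD□ G H = HasEOD (□-adj G H)

-- Complete bipartite graph K_{m,n}: partite sets Fin m (vertices 1..m)
-- and Fin n (vertices m+1..m+n).

open import Data.Fin.Properties using (+↔⊎)
open import Function.Construct.Symmetry using (↔-sym)

K-adj : (m n : ℕ) → Fin m ⊎ Fin n → Fin m ⊎ Fin n → Bool
K-adj m n (inj₁ _) (inj₁ _) = false
K-adj m n (inj₁ _) (inj₂ _) = true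
K-adj m n (inj₂ _) (inj₁ _) = true
K-adj m n (inj₂ _) (inj₂ _) = false

K : ℕ → ℕ → Graph
K m n = record
  { Vertex = Fin m ⊎ Fin n
  ; size = m + n
  ; enum = ↔-sym +↔⊎
  ; adj = K-adj m n
  ; adj-sym = λ { (inj₁ _) (inj₁ _) → refl ; (inj₁ _) (inj₂ _) → refl
                ; (inj₂ _) (inj₁ _) → refl ; (inj₂ _) (inj₂ _) → refl }
  ; adj-irrefl = λ { (inj₁ _) → refl ; (inj₂ _) → refl }
  }

-- K_{m,n}-amenability.  A weak partition of V(G) into the mn+m+n+1
-- (possibly empty) parts V_0, V_1..V_m, V_{m+1}..V_{m+n}, V_[i,m+j]
-- is given by a labelling of the vertices by part names.

data Part (m n : ℕ) : Set where
  p0 : Part m n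
  pL : Fin m → Part m n
  pR : Fin n → Part m n
  pLR : Fin m → Fin n → Part m n

module _ (m n : ℕ) (G : Graph) (f : Vertex G → Part m n) where
  private
    ExOne = ExactlyOneNbr (adj G)
    In : Part m n → Vertex G → Set
    In p w = f w ≡ p

  CondI : Set
  CondI = (∀ i x → In (pL i) x → ExOne (In (pL i)) x)
        × (∀ j x → In (pR j) x → ExOne (In (pR j)) x)

  CondII : Set
  CondII = ∀ i j x → (In (pL i) x ⊎ In (pR j) x) →
             ExOne (λ w → In (pL i) w ⊎ In (pR j) w) x

  CondIII : Set
  CondIII =
    (∀ (i i′ : Fin m) → i < i′ →
       (∀ x → In (pL i) x → ExOne (In (pL i′)) x) ×
       (∀ y → In (pL i′) y → ExOne (In (pL i)) y)) ×
    (∀ (j j′ : Fin n) → j < j′ →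
       (∀ x → In (pR j) x → ExOne (In (pR j′)) x) ×
       (∀ y → In (pR j′) y → ExOne (In (pR j)) y))

  CondIV : Set
  CondIV = ∀ i j x → In (pLR i j) x → ∀ w → Adj (adj G) x w → In p0 w

  CondV : Set
  CondV = ∀ x → In p0 x →
    (∀ i → ExOne (λ w → (∃[ j ] In (pLR i j) w) ⊎ In (pL i) w) x) ×
    (∀ j → ExOne (λ w → (∃[ i ] In (pLR i j) w) ⊎ In (pR j) w) x)

Amenable : (m n : ℕ) → Graph → Set
Amenable m n G = ∃[ f ] (CondI m n G f × CondII m n G f × CondIII m n G f
                          × CondIV m n G f × CondV m n G f)

module Submission where

-- The proof rests on one
-- observation: in an EOD set D of G □ K_{m,n} the fibre
-- {a ∈ V(K_{m,n}) : (g , a) ∈ D} of each g ∈ V(G) contains at most one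
-- vertex of each partite set (two of them would share the neighbour
-- (g , b) for any b on the other side).  Such a fibre is ∅, {i}, {m+j}
-- or {i , m+j}, i.e. exactly the name of a part V_0, V_i, V_{m+j} or
-- V_[i,m+j] of an amenability partition.  So both sides of the theorem
-- are statements about a labelling f : V(G) → Part m n:
--   * EOD sets of G □ K_{m,n} correspond to "EOD labellings", labellings
--     whose induced set D_f = {(g , a) : a ∈ Label (f g)} dominates every
--     vertex and in which no vertex has two D_f-neighbours;
--   * a labelling is an EOD labelling iff it satisfies (I)–(V).

open import Defs
open import Data.Nat using (ℕ; _≤_; zero; suc)
open import Data.Bool using (Bool; true; false; _∧_; _∨_)
import Data.Bool.Properties as Bool
open import Data.Fin using (Fin; zero; _≟_)
open import Data.Fin.Properties using (<-cmp; any?)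
open import Data.Maybe using (Maybe; just; nothing)
import Data.Maybe.Properties as Maybe
open import Data.Sum using (_⊎_; inj₁; inj₂; [_,_])
open import Data.Sum.Properties using (inj₁-injective; inj₂-injective)
open import Data.Sum.Function.Propositional using (_⊎-⇔_)
open import Data.Product using (_×_; _,_; proj₁; proj₂; ∃; ∃-syntax)
open import Data.Product.Function.NonDependent.Propositional using (_×-⇔_)
open import Data.Product.Properties using () renaming (≡-dec to ×-≡-dec)
open import Data.Empty using (⊥-elim)
open import Function using (id; case_of_)
open import Function.Bundles using (_⇔_; mk⇔; Equivalence; Inverse; Injection)
open import Function.Construct.Composition using (_⇔-∘_)
open import Function.Construct.Identity using (⇔-id)
open import Function.Properties.Inverse using (Inverse⇒Injection)
open import Relation.Binary.Definitions using (DecidableEquality; tri<; tri≈; tri>)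
open import Relation.Binary.PropositionalEquality
  using (_≡_; _≢_; refl; sym; trans; cong; subst)
open import Relation.Nullary using (¬_; Dec; yes; no; does; map′)

open Equivalence using (to; from)

∧-true⇔ : ∀ x y → x ∧ y ≡ true ⇔ (x ≡ true × y ≡ true)
∧-true⇔ true  y = mk⇔ (refl ,_) proj₂
∧-true⇔ false y = mk⇔ (λ ()) λ { (() , _) }

∨-true⇔ : ∀ x y → x ∨ y ≡ true ⇔ (x ≡ true ⊎ y ≡ true)
∨-true⇔ true  y = mk⇔ (λ _ → inj₁ refl) (λ _ → refl)
∨-true⇔ false y = mk⇔ inj₂ λ { (inj₁ ()) ; (inj₂ e) → e }

does⇔ : {A : Set} (d : Dec A) → does d ≡ true ⇔ A
does⇔ (yes a) = mk⇔ (λ _ → a) (λ _ → refl)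
does⇔ (no ¬a) = mk⇔ (λ ()) (λ a → ⊥-elim (¬a a))

module _ (X : Graph) where
  open Inverse (enum X) using () renaming (to to index)

  index-injective : ∀ {u v} → index u ≡ index v → u ≡ v
  index-injective = Injection.injective (Inverse⇒Injection (enum X))

  eqb⇔≡ : ∀ u v → eqb X u v ≡ true ⇔ u ≡ v
  eqb⇔≡ u v = mk⇔ (sound u v) λ { refl → complete u }
    where
      sound : ∀ u v → eqb X u v ≡ true → u ≡ v
      sound u v e with index u ≟ index v
      ... | yes p = index-injective p
      sound u v () | no _
      complete : ∀ u → eqb X u u ≡ true
      complete u with index u ≟ index u
      ... | yes _ = refl
      ... | no ¬p with () ← ¬p refl

  vertex-≟ : DecidableEquality (Vertex X)
  vertex-≟ u v = map′ index-injective (cong index) (index u ≟ index v)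

module _ (G H : Graph) where
  □Adj : Vertex G × Vertex H → Vertex G × Vertex H → Set
  □Adj (g , h) (g′ , h′) = (g ≡ g′ × Adj (adj H) h h′) ⊎ (h ≡ h′ × Adj (adj G) g g′)

  □-adj⇔□Adj : ∀ u v → Adj (□-adj G H) u v ⇔ □Adj u v
  □-adj⇔□Adj (g , h) (g′ , h′) =
    (   (eqb⇔≡ G g g′ ×-⇔ ⇔-id _) ⇔-∘ ∧-true⇔ _ _
    ⊎-⇔ (eqb⇔≡ H h h′ ×-⇔ ⇔-id _) ⇔-∘ ∧-true⇔ _ _)
    ⇔-∘ ∨-true⇔ _ _

module Neighbourhood (X : Graph) where
  infix 4 _~_
  _~_ : Vertex X → Vertex X → Set
  _~_ = Adj (adj X)

  ~-sym : ∀ {u v} → u ~ v → v ~ u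
  ~-sym {u} {v} e = trans (adj-sym X v u) e

  ~-irrefl : ∀ {u} → ¬ u ~ u
  ~-irrefl {u} e with () ← trans (sym (adj-irrefl X u)) e

  ExactlyOne : (Vertex X → Set) → Vertex X → Set
  ExactlyOne = ExactlyOneNbr (adj X)

  exactlyOne-unique : ∀ {P x w₁ w₂} → ExactlyOne P x →
                      P w₁ → x ~ w₁ → P w₂ → x ~ w₂ → w₁ ≡ w₂
  exactlyOne-unique (_ , _ , _ , only) p₁ x~w₁ p₂ x~w₂ =
    trans (only _ p₁ x~w₁) (sym (only _ p₂ x~w₂))

  exactlyOne-cong : ∀ {P Q x} → (∀ w → x ~ w → P w ⇔ Q w) →
                    ExactlyOne P x → ExactlyOne Q x
  exactlyOne-cong P⇔Q (w , pw , x~w , only) =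
    w , to (P⇔Q w x~w) pw , x~w ,
    λ w′ qw′ x~w′ → only w′ (from (P⇔Q w′ x~w′) qw′) x~w′

select : {A : Set} {P : A → Set} → Dec (∃ P) → Maybe A
select (yes (a , _)) = just a
select (no _)        = nothing

select-just⇔ : {A : Set} {P : A → Set} → (∀ {a a′} → P a → P a′ → a ≡ a′) →
               (d : Dec (∃ P)) → ∀ a → select d ≡ just a ⇔ P a
select-just⇔ unique (yes (a′ , pa′)) a = mk⇔ (λ { refl → pa′ }) (λ pa → cong just (unique pa′ pa))
select-just⇔ unique (no ¬p)          a = mk⇔ (λ ()) (λ pa → ⊥-elim (¬p (a , pa)))

module Labels (m n : ℕ) where
  open Neighbourhood (K m n) public using ()
    renaming (_~_ to _~ᴷ_; ~-irrefl to ~ᴷ-irrefl)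

  KVertex : Set
  KVertex = Fin m ⊎ Fin n

  -- The vertex set of K_{m,n} named by a part: V_i ↦ {i}, V_{m+j} ↦ {m+j},
  -- V_[i,m+j] ↦ {i , m+j}, V_0 ↦ ∅.  The shape matches condition (V).
  Label : Part m n → KVertex → Set
  Label p (inj₁ i) = (∃[ j ] p ≡ pLR i j) ⊎ p ≡ pL i
  Label p (inj₂ j) = (∃[ i ] p ≡ pLR i j) ⊎ p ≡ pR j

  leftOf : Part m n → Maybe (Fin m)
  leftOf p0        = nothing
  leftOf (pL i)    = just i
  leftOf (pR _)    = nothing
  leftOf (pLR i _) = just i

  rightOf : Part m n → Maybe (Fin n)
  rightOf p0        = nothing
  rightOf (pL _)    = nothing
  rightOf (pR j)    = just j
  rightOf (pLR _ j) = just j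

  label-left⇔ : ∀ p i → Label p (inj₁ i) ⇔ leftOf p ≡ just i
  label-left⇔ p0        i = mk⇔ (λ { (inj₁ (_ , ())) ; (inj₂ ()) }) λ ()
  label-left⇔ (pL _)    i = mk⇔ (λ { (inj₁ (_ , ())) ; (inj₂ refl) → refl }) λ { refl → inj₂ refl }
  label-left⇔ (pR _)    i = mk⇔ (λ { (inj₁ (_ , ())) ; (inj₂ ()) }) λ ()
  label-left⇔ (pLR _ j) i = mk⇔ (λ { (inj₁ (_ , refl)) → refl ; (inj₂ ()) }) λ { refl → inj₁ (j , refl) }

  label-right⇔ : ∀ p j → Label p (inj₂ j) ⇔ rightOf p ≡ just j
  label-right⇔ p0        j = mk⇔ (λ { (inj₁ (_ , ())) ; (inj₂ ()) }) λ ()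
  label-right⇔ (pL _)    j = mk⇔ (λ { (inj₁ (_ , ())) ; (inj₂ ()) }) λ ()
  label-right⇔ (pR _)    j = mk⇔ (λ { (inj₁ (_ , ())) ; (inj₂ refl) → refl }) λ { refl → inj₂ refl }
  label-right⇔ (pLR i _) j = mk⇔ (λ { (inj₁ (_ , refl)) → refl ; (inj₂ ()) }) λ { refl → inj₁ (i , refl) }

  label? : ∀ p a → Dec (Label p a)
  label? p (inj₁ i) = map′ (from (label-left⇔ p i)) (to (label-left⇔ p i))
                           (Maybe.≡-dec _≟_ (leftOf p) (just i))
  label? p (inj₂ j) = map′ (from (label-right⇔ p j)) (to (label-right⇔ p j))
                           (Maybe.≡-dec _≟_ (rightOf p) (just j))

  label-p0 : ∀ {a} → ¬ Label p0 a
  label-p0 {inj₁ _} (inj₁ (_ , ()))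
  label-p0 {inj₁ _} (inj₂ ())
  label-p0 {inj₂ _} (inj₁ (_ , ()))
  label-p0 {inj₂ _} (inj₂ ())

  p0-or-labelled : ∀ p → p ≡ p0 ⊎ ∃[ a ] Label p a
  p0-or-labelled p0        = inj₁ refl
  p0-or-labelled (pL i)    = inj₂ (inj₁ i , inj₂ refl)
  p0-or-labelled (pR j)    = inj₂ (inj₂ j , inj₂ refl)
  p0-or-labelled (pLR i j) = inj₂ (inj₁ i , inj₁ (j , refl))

  -- A label has at most one vertex on each side: two of its vertices with
  -- a common neighbour in K_{m,n} coincide.
  label-unique : ∀ {p a₁ a₂ b} → a₁ ~ᴷ b → a₂ ~ᴷ b → Label p a₁ → Label p a₂ → a₁ ≡ a₂
  label-unique {p} {inj₁ i₁} {inj₁ i₂} _ _ l₁ l₂ =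
    cong inj₁ (Maybe.just-injective (trans (sym (to (label-left⇔ p i₁) l₁)) (to (label-left⇔ p i₂) l₂)))
  label-unique {p} {inj₂ j₁} {inj₂ j₂} _ _ l₁ l₂ =
    cong inj₂ (Maybe.just-injective (trans (sym (to (label-right⇔ p j₁) l₁)) (to (label-right⇔ p j₂) l₂)))
  label-unique {a₁ = inj₁ _} {inj₂ _} {inj₁ _} () _ _ _
  label-unique {a₁ = inj₁ _} {inj₂ _} {inj₂ _} _ () _ _
  label-unique {a₁ = inj₂ _} {inj₁ _} {inj₁ _} _ () _ _
  label-unique {a₁ = inj₂ _} {inj₁ _} {inj₂ _} () _ _ _

  part : Maybe (Fin m) → Maybe (Fin n) → Part m n
  part nothing  nothing  = p0
  part (just i) nothing  = pL i
  part nothing  (just j) = pR j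
  part (just i) (just j) = pLR i j

  leftOf-part : ∀ x y → leftOf (part x y) ≡ x
  leftOf-part nothing  nothing  = refl
  leftOf-part (just _) nothing  = refl
  leftOf-part nothing  (just _) = refl
  leftOf-part (just _) (just _) = refl

  rightOf-part : ∀ x y → rightOf (part x y) ≡ y
  rightOf-part nothing  nothing  = refl
  rightOf-part (just _) nothing  = refl
  rightOf-part nothing  (just _) = refl
  rightOf-part (just _) (just _) = refl

  label-part-left⇔ : ∀ x y i → Label (part x y) (inj₁ i) ⇔ x ≡ just i
  label-part-left⇔ x y i =
    mk⇔ (trans (sym (leftOf-part x y))) (trans (leftOf-part x y)) ⇔-∘ label-left⇔ (part x y) i

  label-part-right⇔ : ∀ x y j → Label (part x y) (inj₂ j) ⇔ y ≡ just j
  label-part-right⇔ x y j =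
    mk⇔ (trans (sym (rightOf-part x y))) (trans (rightOf-part x y)) ⇔-∘ label-right⇔ (part x y) j

module Labelling (m n : ℕ) (G : Graph) where
  open Labels m n public
  open Neighbourhood G public

  Vertex□ : Set
  Vertex□ = Vertex G × KVertex

  infix 4 _~□_
  _~□_ : Vertex□ → Vertex□ → Set
  _~□_ = □Adj G (K m n)

  InD : (Vertex G → Part m n) → Vertex□ → Set
  InD f (g , a) = Label (f g) a

  Dominating : (Vertex G → Part m n) → Set
  Dominating f = ∀ x → ∃[ v ] (InD f v × v ~□ x)

  Separating : (Vertex G → Part m n) → Set
  Separating f = ∀ {u v x} → InD f u → InD f v → u ~□ x → v ~□ x → u ≡ v

  EODLabelling : (Vertex G → Part m n) → Set
  EODLabelling f = Dominating f × Separating f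

  -- D_f is decidable, so an EOD labelling yields an EOD set of G □ K_{m,n}.
  labelling⇒EOD : ∀ {f} → EODLabelling f → IsEOD□ G (K m n)
  labelling⇒EOD {f} (dominating , separating) = D , covers , disjoint
    where
      D : Vertex□ → Bool
      D (g , a) = does (label? (f g) a)
      D⇔InD : ∀ v → D v ≡ true ⇔ InD f v
      D⇔InD (g , a) = does⇔ (label? (f g) a)
      adj⇔ : ∀ u v → Adj (□-adj G (K m n)) u v ⇔ u ~□ v
      adj⇔ = □-adj⇔□Adj G (K m n)
      covers : ∀ x → ∃[ v ] (D v ≡ true × Adj (□-adj G (K m n)) v x)
      covers x with dominating x
      ... | v , v∈D , v~x = v , from (D⇔InD v) v∈D , from (adj⇔ v x) v~x
      disjoint : ∀ u v → D u ≡ true → D v ≡ true → u ≢ v → ∀ x →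
                 ¬ (Adj (□-adj G (K m n)) u x × Adj (□-adj G (K m n)) v x)
      disjoint u v u∈D v∈D u≢v x (u~x , v~x) =
        u≢v (separating (to (D⇔InD u) u∈D) (to (D⇔InD v) v∈D) (to (adj⇔ u x) u~x) (to (adj⇔ v x) v~x))

  -- Conversely, if both sides of K_{m,n} are nonempty, every EOD set D of
  -- G □ K_{m,n} is D_f, where f g names the fibre of D over g.
  EOD⇒labelling : Fin m → Fin n → IsEOD□ G (K m n) → ∃ EODLabelling
  EOD⇒labelling i₀ j₀ (D , covers , disjoint) = labelOf , dominating , separating
    where
      adj⇔ : ∀ u v → Adj (□-adj G (K m n)) u v ⇔ u ~□ v
      adj⇔ = □-adj⇔□Adj G (K m n)

      D-separating : ∀ {u v x} → D u ≡ true → D v ≡ true → u ~□ x → v ~□ x → u ≡ v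
      D-separating {u} {v} {x} u∈D v∈D u~x v~x with ×-≡-dec (vertex-≟ G) (vertex-≟ (K m n)) u v
      ... | yes u≡v = u≡v
      ... | no  u≢v = ⊥-elim (disjoint u v u∈D v∈D u≢v x (from (adj⇔ u x) u~x , from (adj⇔ v x) v~x))

      fibre-unique : ∀ {g a₁ a₂ b} → D (g , a₁) ≡ true → D (g , a₂) ≡ true →
                     a₁ ~ᴷ b → a₂ ~ᴷ b → a₁ ≡ a₂
      fibre-unique a₁∈D a₂∈D a₁~b a₂~b =
        cong proj₂ (D-separating a₁∈D a₂∈D (inj₁ (refl , a₁~b)) (inj₁ (refl , a₂~b)))

      InLeftFibre : Vertex G → Fin m → Set
      InLeftFibre g i = D (g , inj₁ i) ≡ true

      InRightFibre : Vertex G → Fin n → Set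
      InRightFibre g j = D (g , inj₂ j) ≡ true

      left-fibre? : ∀ g → Dec (∃ (InLeftFibre g))
      left-fibre? g = any? λ i → D (g , inj₁ i) Bool.≟ true

      right-fibre? : ∀ g → Dec (∃ (InRightFibre g))
      right-fibre? g = any? λ j → D (g , inj₂ j) Bool.≟ true

      labelOf : Vertex G → Part m n
      labelOf g = part (select (left-fibre? g)) (select (right-fibre? g))

      label⇔D : ∀ v → InD labelOf v ⇔ D v ≡ true
      label⇔D (g , inj₁ i) =
        select-just⇔ (λ d₁ d₂ → Data.Sum.Properties.inj₁-injective (fibre-unique {b = inj₂ j₀} d₁ d₂ refl refl))
                     (left-fibre? g) i
        ⇔-∘ label-part-left⇔ _ _ i
      label⇔D (g , inj₂ j) =
        select-just⇔ (λ d₁ d₂ → Data.Sum.Properties.inj₂-injective (fibre-unique {b = inj₁ i₀} d₁ d₂ refl refl))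
                     (right-fibre? g) j
        ⇔-∘ label-part-right⇔ _ _ j

      dominating : Dominating labelOf
      dominating x with covers x
      ... | v , v∈D , v~x = v , from (label⇔D v) v∈D , to (adj⇔ v x) v~x

      separating : Separating labelOf
      separating {u} {v} u∈D v∈D = D-separating (to (label⇔D u) u∈D) (to (label⇔D v) v∈D)

module EODLabelling⇒Amenable (m n : ℕ) (G : Graph) (f : Vertex G → Part m n)
                             (dominating : Labelling.Dominating m n G f)
                             (separating : Labelling.Separating m n G f) where
  open Labelling m n G

  not-both : ∀ {x w a b} → Label (f x) b → b ~ᴷ a → x ~ w → ¬ Label (f w) a
  not-both {x} {w} {a} {b} lb b~a x~w la =
    ~ᴷ-irrefl (subst (_~ᴷ a) (sym a≡b) b~a)
    where
      a≡b : a ≡ b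
      a≡b = cong proj₂ (separating {w , a} {x , b} la lb (inj₂ (refl , ~-sym x~w)) (inj₁ (refl , b~a)))

  opposite-label : ∀ {x i j} → f x ≡ pLR i j → ∀ a → ∃[ b ] (Label (f x) b × b ~ᴷ a)
  opposite-label {j = j} e (inj₁ _) = inj₂ j , inj₁ (_ , e) , refl
  opposite-label {i = i} e (inj₂ _) = inj₁ i , inj₁ (_ , e) , refl

  condIV : CondIV m n G f
  condIV i j x e w x~w with p0-or-labelled (f w)
  ... | inj₁ fw≡p0 = fw≡p0
  ... | inj₂ (a , la) with opposite-label e a
  ... | b , lb , b~a = ⊥-elim (not-both lb b~a x~w la)

  -- If no label of x is adjacent to a, the vertex (x , a) is dominated
  -- through its G-fibre, hence by exactly one neighbour of x.
  vertical-domination : ∀ x a → (∀ b → Label (f x) b → ¬ b ~ᴷ a) →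
                        ExactlyOne (λ w → Label (f w) a) x
  vertical-domination x a no-horizontal with dominating (x , a)
  ... | (g , b) , lb , inj₁ (refl , b~a) = ⊥-elim (no-horizontal b lb b~a)
  ... | (g , a) , la , inj₂ (refl , g~x) =
    g , la , ~-sym g~x ,
    λ w lw x~w → cong proj₁ (separating lw la (inj₂ (refl , ~-sym x~w)) (inj₂ (refl , g~x)))

  -- A vertex of V_i has exactly one neighbour in each V_{i′}: the vertex
  -- (x , i′) is not dominated inside its K_{m,n}-fibre, and by (IV) its
  -- dominating neighbour in G lies in V_{i′} rather than some V_[i′,m+j].
  left-to-left : ∀ {x i} → f x ≡ pL i → ∀ i′ → ExactlyOne (λ w → f w ≡ pL i′) x
  left-to-left {x} {i} e i′ = exactlyOne-cong agree (vertical-domination x (inj₁ i′) no-horizontal)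
    where
      no-horizontal : ∀ b → Label (f x) b → ¬ b ~ᴷ inj₁ i′
      no-horizontal (inj₁ _) _ ()
      no-horizontal (inj₂ _) (inj₁ (_ , e′)) _ = case trans (sym e) e′ of λ ()
      no-horizontal (inj₂ _) (inj₂ e′)       _ = case trans (sym e) e′ of λ ()
      agree : ∀ w → x ~ w → Label (f w) (inj₁ i′) ⇔ f w ≡ pL i′
      agree w x~w = mk⇔ (λ { (inj₁ (j , e′)) → case trans (sym e) (condIV i′ j w e′ x (~-sym x~w)) of λ ()
                           ; (inj₂ e′) → e′ })
                        inj₂

  right-to-right : ∀ {x j} → f x ≡ pR j → ∀ j′ → ExactlyOne (λ w → f w ≡ pR j′) x
  right-to-right {x} {j} e j′ = exactlyOne-cong agree (vertical-domination x (inj₂ j′) no-horizontal)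
    where
      no-horizontal : ∀ b → Label (f x) b → ¬ b ~ᴷ inj₂ j′
      no-horizontal (inj₂ _) _ ()
      no-horizontal (inj₁ _) (inj₁ (_ , e′)) _ = case trans (sym e) e′ of λ ()
      no-horizontal (inj₁ _) (inj₂ e′)       _ = case trans (sym e) e′ of λ ()
      agree : ∀ w → x ~ w → Label (f w) (inj₂ j′) ⇔ f w ≡ pR j′
      agree w x~w = mk⇔ (λ { (inj₁ (i , e′)) → case trans (sym e) (condIV i j′ w e′ x (~-sym x~w)) of λ ()
                           ; (inj₂ e′) → e′ })
                        inj₂

  condI : CondI m n G f
  condI = (λ i x e → left-to-left e i) , (λ j x e → right-to-right e j)

  -- (II): a vertex of V_i has no neighbour in V_{m+j}, since (x , m+j) is
  -- already dominated by (x , i); symmetrically for V_{m+j}.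
  condII : CondII m n G f
  condII i j x (inj₁ e) = exactlyOne-cong agree (left-to-left e i)
    where
      agree : ∀ w → x ~ w → f w ≡ pL i ⇔ (f w ≡ pL i ⊎ f w ≡ pR j)
      agree w x~w = mk⇔ inj₁ [ id , (λ e′ → ⊥-elim (not-both {a = inj₂ j} {b = inj₁ i} (inj₂ e) refl x~w (inj₂ e′))) ]
  condII i j x (inj₂ e) = exactlyOne-cong agree (right-to-right e j)
    where
      agree : ∀ w → x ~ w → f w ≡ pR j ⇔ (f w ≡ pL i ⊎ f w ≡ pR j)
      agree w x~w = mk⇔ inj₂ [ (λ e′ → ⊥-elim (not-both {a = inj₁ i} {b = inj₂ j} (inj₂ e) refl x~w (inj₂ e′))) , id ]

  condIII : CondIII m n G f
  condIII = (λ i i′ _ → (λ x e → left-to-left e i′) , (λ y e → left-to-left e i))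
          , (λ j j′ _ → (λ x e → right-to-right e j′) , (λ y e → right-to-right e j))

  -- (V): a vertex of V_0 has no labels, so each (x , a) is dominated through G.
  condV : CondV m n G f
  condV x e = (λ i → vertical-domination x (inj₁ i) unlabelled)
            , (λ j → vertical-domination x (inj₂ j) unlabelled)
    where
      unlabelled : ∀ {a} b → Label (f x) b → ¬ b ~ᴷ a
      unlabelled b lb _ = label-p0 (subst (λ p → Label p b) e lb)

  amenable : Amenable m n G
  amenable = f , condI , condII , condIII , condIV , condV

module Amenable⇒EODLabelling (m n : ℕ) (G : Graph) (f : Vertex G → Part m n)
                             (condI : CondI m n G f) (condII : CondII m n G f)
                             (condIII : CondIII m n G f) (condIV : CondIV m n G f)
                             (condV : CondV m n G f) where
  open Labelling m n G

  -- (I) and (III): a vertex of V_i has exactly one neighbour in every V_{i′}.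
  left-to-left : ∀ {x i} → f x ≡ pL i → ∀ i′ → ExactlyOne (λ w → f w ≡ pL i′) x
  left-to-left {x} {i} e i′ with <-cmp i i′
  ... | tri< i<i′ _ _ = proj₁ (proj₁ condIII i i′ i<i′) x e
  ... | tri≈ _ refl _ = proj₁ condI i x e
  ... | tri> _ _ i′<i = proj₂ (proj₁ condIII i′ i i′<i) x e

  right-to-right : ∀ {x j} → f x ≡ pR j → ∀ j′ → ExactlyOne (λ w → f w ≡ pR j′) x
  right-to-right {x} {j} e j′ with <-cmp j j′
  ... | tri< j<j′ _ _ = proj₁ (proj₂ condIII j j′ j<j′) x e
  ... | tri≈ _ refl _ = proj₂ condI j x e
  ... | tri> _ _ j′<j = proj₂ (proj₂ condIII j′ j j′<j) x e

  -- (II) and (I): a vertex of V_i has no neighbour in V_{m+j}, because its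
  -- unique neighbour in V_i ∪ V_{m+j} is its neighbour in V_i; and dually.
  left-no-right : ∀ {x w i j} → f x ≡ pL i → x ~ w → f w ≢ pR j
  left-no-right {x} {w} {i} {j} e x~w e′ with proj₁ condI i x e
  ... | w₁ , e₁ , x~w₁ , _ =
    case trans (sym e′) (trans (cong f w≡w₁) e₁) of λ ()
    where
      w≡w₁ : w ≡ w₁
      w≡w₁ = exactlyOne-unique (condII i j x (inj₁ e)) (inj₂ e′) x~w (inj₁ e₁) x~w₁

  right-no-left : ∀ {x w i j} → f x ≡ pR j → x ~ w → f w ≢ pL i
  right-no-left {x} {w} {i} {j} e x~w e′ with proj₂ condI j x e
  ... | w₁ , e₁ , x~w₁ , _ =
    case trans (sym e′) (trans (cong f w≡w₁) e₁) of λ ()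
    where
      w≡w₁ : w ≡ w₁
      w≡w₁ = exactlyOne-unique (condII i j x (inj₂ e)) (inj₁ e′) x~w (inj₂ e₁) x~w₁

  -- (IV): the neighbours of a vertex of V_[i,m+j] carry no label.
  unlabelled-near-pLR : ∀ {x w i j a} → f x ≡ pLR i j → x ~ w → ¬ Label (f w) a
  unlabelled-near-pLR {w = w} {i} {j} {a} e x~w lw =
    label-p0 (subst (λ p → Label p a) (condIV i j _ e w x~w) lw)

  -- (IV) again: a labelled neighbour of a vertex outside V_0 lies in V_i
  -- or V_{m+j}, not in some V_[i,m+j].
  neighbour-left : ∀ {x w p i} → f x ≡ p → p ≢ p0 → x ~ w → Label (f w) (inj₁ i) → f w ≡ pL i
  neighbour-left e p≢p0 x~w (inj₂ e′)      = e′
  neighbour-left {x} {w} {i = i} e p≢p0 x~w (inj₁ (j , e′)) =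
    ⊥-elim (p≢p0 (trans (sym e) (condIV i j w e′ x (~-sym x~w))))

  neighbour-right : ∀ {x w p j} → f x ≡ p → p ≢ p0 → x ~ w → Label (f w) (inj₂ j) → f w ≡ pR j
  neighbour-right e p≢p0 x~w (inj₂ e′)      = e′
  neighbour-right {x} {w} {j = j} e p≢p0 x~w (inj₁ (i , e′)) =
    ⊥-elim (p≢p0 (trans (sym e) (condIV i j w e′ x (~-sym x~w))))

  vertical-unique : ∀ {x w₁ w₂ a} → x ~ w₁ → x ~ w₂ → Label (f w₁) a → Label (f w₂) a → w₁ ≡ w₂
  vertical-unique {x} {a = a} x~w₁ x~w₂ l₁ l₂ with f x in e | a
  ... | p0      | inj₁ i  = exactlyOne-unique (proj₁ (condV x e) i) l₁ x~w₁ l₂ x~w₂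
  ... | p0      | inj₂ j  = exactlyOne-unique (proj₂ (condV x e) j) l₁ x~w₁ l₂ x~w₂
  ... | pLR i j | _       = ⊥-elim (unlabelled-near-pLR e x~w₁ l₁)
  ... | pL i    | inj₁ i′ = exactlyOne-unique (left-to-left e i′)
                              (neighbour-left e (λ ()) x~w₁ l₁) x~w₁ (neighbour-left e (λ ()) x~w₂ l₂) x~w₂
  ... | pL i    | inj₂ j′ = ⊥-elim (left-no-right e x~w₁ (neighbour-right e (λ ()) x~w₁ l₁))
  ... | pR j    | inj₂ j′ = exactlyOne-unique (right-to-right e j′)
                              (neighbour-right e (λ ()) x~w₁ l₁) x~w₁ (neighbour-right e (λ ()) x~w₂ l₂) x~w₂
  ... | pR j    | inj₁ i′ = ⊥-elim (right-no-left e x~w₁ (neighbour-left e (λ ()) x~w₁ l₁))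

  not-both : ∀ {x w a b} → Label (f x) b → b ~ᴷ a → x ~ w → ¬ Label (f w) a
  not-both {a = a@(inj₂ _)} {inj₁ _} (inj₁ (_ , e)) _ x~w lw = unlabelled-near-pLR {a = a} e x~w lw
  not-both {a = inj₂ _} {inj₁ _} (inj₂ e)       _ x~w lw =
    left-no-right e x~w (neighbour-right e (λ ()) x~w lw)
  not-both {a = a@(inj₁ _)} {inj₂ _} (inj₁ (_ , e)) _ x~w lw = unlabelled-near-pLR {a = a} e x~w lw
  not-both {a = inj₁ _} {inj₂ _} (inj₂ e)       _ x~w lw =
    right-no-left e x~w (neighbour-left e (λ ()) x~w lw)
  not-both {a = inj₁ _} {inj₁ _} _ ()
  not-both {a = inj₂ _} {inj₂ _} _ ()

  separating : Separating f
  separating l₁ l₂ (inj₁ (refl , a₁~a)) (inj₁ (refl , a₂~a)) = cong (_ ,_) (label-unique a₁~a a₂~a l₁ l₂)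
  separating l₁ l₂ (inj₁ (refl , a₁~a)) (inj₂ (refl , g₂~g)) = ⊥-elim (not-both l₁ a₁~a (~-sym g₂~g) l₂)
  separating l₁ l₂ (inj₂ (refl , g₁~g)) (inj₁ (refl , a₂~a)) = ⊥-elim (not-both l₂ a₂~a (~-sym g₁~g) l₁)
  separating l₁ l₂ (inj₂ (refl , g₁~g)) (inj₂ (refl , g₂~g)) = cong (_, _) (vertical-unique (~-sym g₁~g) (~-sym g₂~g) l₁ l₂)

  dominated-vertically : ∀ {g w a} → Label (f w) a → g ~ w → ∃[ v ] (InD f v × v ~□ (g , a))
  dominated-vertically {w = w} {a} lw g~w = (w , a) , lw , inj₂ (refl , ~-sym g~w)

  -- (g , a) is dominated inside its K_{m,n}-fibre when g has a label on the
  -- other side of a, and otherwise through G by (I), (III) or (V).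
  dominating : Dominating f
  dominating (g , inj₁ i′) with f g in e
  ... | p0      = let (w , lw , g~w , _) = proj₁ (condV g e) i′ in dominated-vertically lw g~w
  ... | pL i    = let (w , ew , g~w , _) = left-to-left e i′ in dominated-vertically (inj₂ ew) g~w
  ... | pR j    = (g , inj₂ j) , inj₂ e , inj₁ (refl , refl)
  ... | pLR i j = (g , inj₂ j) , inj₁ (i , e) , inj₁ (refl , refl)
  dominating (g , inj₂ j′) with f g in e
  ... | p0      = let (w , lw , g~w , _) = proj₂ (condV g e) j′ in dominated-vertically lw g~w
  ... | pR j    = let (w , ew , g~w , _) = right-to-right e j′ in dominated-vertically (inj₂ ew) g~w
  ... | pL i    = (g , inj₁ i) , inj₂ e , inj₁ (refl , refl)
  ... | pLR i j = (g , inj₁ i) , inj₁ (j , e) , inj₁ (refl , refl)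

  eodLabelling : EODLabelling f
  eodLabelling = dominating , separating

EOD□⇔amenable : ∀ {m n} → Fin m → Fin n → (G : Graph) → IsEOD□ G (K m n) ⇔ Amenable m n G
EOD□⇔amenable {m} {n} i₀ j₀ G = mk⇔ EOD⇒amenable amenable⇒EOD
  where
    open Labelling m n G using (EOD⇒labelling; labelling⇒EOD)

    EOD⇒amenable : IsEOD□ G (K m n) → Amenable m n G
    EOD⇒amenable eod with EOD⇒labelling i₀ j₀ eod
    ... | f , dominating , separating = EODLabelling⇒Amenable.amenable m n G f dominating separating

    amenable⇒EOD : Amenable m n G → IsEOD□ G (K m n)
    amenable⇒EOD (f , I , II , III , IV , V) =
      labelling⇒EOD (Amenable⇒EODLabelling.eodLabelling m n G f I II III IV V)

mainTheorem7 : (m n : ℕ) → 1 ≤ m → m ≤ n → (G : Graph) →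
                 IsEOD□ G (K m n) ⇔ Amenable m n G
mainTheorem7 zero    _       ()  _  G
mainTheorem7 (suc _) zero    _   () G
mainTheorem7 (suc _) (suc _) _   _  G = EOD□⇔amenable zero zero G
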